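{- Let $n\ge1$ and let $k,k'$ be integers with $1\le k<k'\le n$. Let $p^i_k\in\phi(n,k)$ be a major motif and let $\psi=\bigcup_{y=k'}^{n}\phi(n,y)$. Then for every $q\in\psi$ with $q[1]\le p^i_k[1]$, we have $p^i_k\succeq q$.
   Context: A motif of $n$ is a finite non-increasing sequence $p=(p[1],\dots,p[k])$ of positive integers with sum $n$; its length is $|p|=k$, and $\phi(n,k)$ is the set of motifs of $n$ of length $k$; $p^i_k$ denotes the $i$-th motif of $\phi(n,k)$ in decreasing lexicographic order. For motifs $p,q$ of $n$, $p\succeq q$ means $\sum_{x=1}^t p[x]\ge\sum_{x=1}^t q[x]$ for every $1\le t\le\min(|p|,|q|)$. A motif $p\in\phi(n,k)$ is major if there is an integer $\lambda$ with $\lceil n/k\rceil\le\lambda\le n-k+1$ and $\lambda\ge2$ such that, writing $\beta=\lfloor (n-k)/(\lambda-1)\rfloor$, one has $p[x]=\lambda$ for $1\le x\le\beta$, $p[\beta+1]=n-\beta\lambda-(k-\beta-1)$ (when $\beta+1\le k$), and $p[x]=1$ for $\beta+1<x\le k$. -}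

module Defs where

open import Data.Nat using (ℕ; zero; suc; _+_; _*_; _∸_; _≤_; _<_)
open import Data.Nat.DivMod using (_/_)
open import Data.List using (List; []; _∷_; length; take)
open import Data.Nat.ListAction using (sum)
open import Relation.Binary.PropositionalEquality using (_≡_)
open import Data.List.Relation.Unary.All using (All)
open import Data.List.Relation.Unary.Linked using (Linked)
open import Data.Product using (_×_; ∃)
open import Data.Nat using (_≥_)

-- 1-indexed lookup p[x]; returns 0 outside 1..|p| (never equal to a part of a motif)
_[_] : List ℕ → ℕ → ℕ
[] [ _ ] = 0
(a ∷ p) [ zero ] = 0
(a ∷ p) [ suc zero ] = a
(a ∷ p) [ suc (suc x) ] = p [ suc x ]

IsMotif : ℕ → List ℕ → Set
IsMotif n p = Linked _≥_ p × All (1 ≤_) p × sum p ≡ n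

InPhi : ℕ → ℕ → List ℕ → Set
InPhi n k p = IsMotif n p × length p ≡ k

-- ⌈ n / k ⌉ for k ≥ 1
ceilDiv : ℕ → ℕ → ℕ
ceilDiv n zero = 0
ceilDiv n (suc k) = (n + k) / suc k

-- β = ⌊ (n-k)/(λ-1) ⌋ (only used for λ ≥ 2)
beta : ℕ → ℕ → ℕ → ℕ
beta n k (suc (suc m)) = (n ∸ k) / suc m
beta n k _ = 0

-- major motif (p assumed in φ(n,k))
IsMajor : ℕ → ℕ → List ℕ → Set
IsMajor n k p = ∃ λ lam →
  ceilDiv n k ≤ lam × lam ≤ n ∸ k + 1 × 2 ≤ lam ×
  (∀ x → 1 ≤ x → x ≤ beta n k lam → p [ x ] ≡ lam) ×
  (beta n k lam + 1 ≤ k →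
     p [ beta n k lam + 1 ] ≡ n ∸ beta n k lam * lam ∸ (k ∸ beta n k lam ∸ 1)) ×
  (∀ x → beta n k lam + 1 < x → x ≤ k → p [ x ] ≡ 1)

_⪰_ : List ℕ → List ℕ → Set
p ⪰ q = ∀ t → 1 ≤ t → t ≤ length p → t ≤ length q → sum (take t q) ≤ sum (take t p)

-- For t ≤ β the major motif p is constantly λ = p[1] on its first t places, and every part of q is
-- at most q[1] ≤ λ, so p wins the prefix of length t. For t > β every part of p after t is 1, so its
-- suffix sums to |p| − t ≤ |q| − t, which is at most the suffix of q since parts of q are positive.
module Submission where

open import Defs
open import Data.Nat using (ℕ; zero; suc; _+_; _*_; _∸_; _≤_; _<_; _≥_; z≤n; s≤s; _≤?_)
open import Data.Nat.Properties
open import Data.Nat.ListAction using (sum)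
open import Data.Nat.ListAction.Properties using (sum-++)
open import Data.List using (List; []; _∷_; length; take; drop)
open import Data.List.Properties using (length-take; length-drop; take++drop≡id)
open import Data.List.Relation.Unary.All using (All; []; _∷_)
open import Data.List.Relation.Unary.All.Properties using (take⁺; drop⁺)
open import Data.List.Relation.Unary.Linked using (Linked)
open import Data.List.Relation.Unary.Linked.Properties using (Linked⇒All)
open import Data.Product using (_,_)
open import Relation.Binary.PropositionalEquality using (_≡_; refl; sym; trans; cong)
open import Relation.Nullary using (yes; no)

open ≤-Reasoning

lookups⇒All-take : ∀ {P : ℕ → Set} (p : List ℕ) t →
  (∀ x → 1 ≤ x → x ≤ t → P (p [ x ])) → All P (take t p)
lookups⇒All-take p zero _ = []
lookups⇒All-take [] (suc t) _ = []
lookups⇒All-take {P} (a ∷ p) (suc t) h = h 1 ≤-refl (s≤s z≤n) ∷ lookups⇒All-take p t h′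
  where
  h′ : ∀ x → 1 ≤ x → x ≤ t → P (p [ x ])
  h′ (suc x) _ x≤t = h (suc (suc x)) (s≤s z≤n) (s≤s x≤t)

lookups⇒All-drop : ∀ {P : ℕ → Set} (p : List ℕ) t →
  (∀ x → t < x → x ≤ length p → P (p [ x ])) → All P (drop t p)
lookups⇒All-drop [] zero _ = []
lookups⇒All-drop [] (suc t) _ = []
lookups⇒All-drop {P} (a ∷ p) zero h = h 1 (s≤s z≤n) (s≤s z≤n) ∷ lookups⇒All-drop p zero h′
  where
  h′ : ∀ x → 0 < x → x ≤ length p → P (p [ x ])
  h′ (suc x) _ x≤l = h (suc (suc x)) (s≤s z≤n) (s≤s x≤l)
lookups⇒All-drop {P} (a ∷ p) (suc t) h = lookups⇒All-drop p t h′
  where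
  h′ : ∀ x → t < x → x ≤ length p → P (p [ x ])
  h′ (suc x) t<x x≤l = h (suc (suc x)) (s≤s t<x) (s≤s x≤l)

All-≤-head : ∀ (q : List ℕ) {l} → Linked _≥_ q → q [ 1 ] ≤ l → All (_≤ l) q
All-≤-head [] _ _ = []
All-≤-head (a ∷ q) q↘ a≤l = Linked⇒All (λ l≥a a≥b → ≤-trans a≥b l≥a) a≤l q↘

sum-constant : ∀ {l} (xs : List ℕ) → All (_≡ l) xs → sum xs ≡ length xs * l
sum-constant [] [] = refl
sum-constant (x ∷ xs) (refl ∷ xs≡l) = cong (x +_) (sum-constant xs xs≡l)

sum-≤-length*bound : ∀ {l} (xs : List ℕ) → All (_≤ l) xs → sum xs ≤ length xs * l
sum-≤-length*bound [] [] = z≤n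
sum-≤-length*bound (x ∷ xs) (x≤l ∷ xs≤l) = +-mono-≤ x≤l (sum-≤-length*bound xs xs≤l)

length≤sum : (xs : List ℕ) → All (1 ≤_) xs → length xs ≤ sum xs
length≤sum [] [] = z≤n
length≤sum (x ∷ xs) (1≤x ∷ 1≤xs) = +-mono-≤ 1≤x (length≤sum xs 1≤xs)

sum-take+sum-drop : ∀ t (q : List ℕ) → sum (take t q) + sum (drop t q) ≡ sum q
sum-take+sum-drop t q = trans (sym (sum-++ (take t q) (drop t q))) (cong sum (take++drop≡id t q))

sum-take-≤-of-constant-prefix : ∀ (p q : List ℕ) t {l} → t ≤ length p →
  All (_≡ l) (take t p) → All (_≤ l) q → sum (take t q) ≤ sum (take t p)
sum-take-≤-of-constant-prefix p q t {l} t≤|p| p≡l q≤l = begin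
  sum (take t q)              ≤⟨ sum-≤-length*bound (take t q) (take⁺ t q≤l) ⟩
  length (take t q) * l       ≤⟨ *-monoˡ-≤ l (≤-trans (≤-reflexive (length-take t q)) (m⊓n≤m t _)) ⟩
  t * l                       ≡⟨ cong (_* l) (sym (trans (length-take t p) (m≤n⇒m⊓n≡m t≤|p|))) ⟩
  length (take t p) * l       ≡⟨ sym (sum-constant (take t p) p≡l) ⟩
  sum (take t p)              ∎

sum-take-≤-of-unit-suffix : ∀ (p q : List ℕ) t → sum p ≡ sum q → length p ≤ length q →
  All (_≡ 1) (drop t p) → All (1 ≤_) q → sum (take t q) ≤ sum (take t p)
sum-take-≤-of-unit-suffix p q t Σp≡Σq |p|≤|q| p≡1 1≤q = +-cancelʳ-≤ (sum (drop t q)) _ _ (begin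
  sum (take t q) + sum (drop t q)   ≡⟨ trans (sum-take+sum-drop t q) (sym Σp≡Σq) ⟩
  sum p                             ≡⟨ sym (sum-take+sum-drop t p) ⟩
  sum (take t p) + sum (drop t p)   ≤⟨ +-monoʳ-≤ (sum (take t p)) suffix ⟩
  sum (take t p) + sum (drop t q)   ∎)
  where
  suffix : sum (drop t p) ≤ sum (drop t q)
  suffix = begin
    sum (drop t p)              ≡⟨ trans (sum-constant (drop t p) p≡1) (*-identityʳ _) ⟩
    length (drop t p)           ≡⟨ length-drop t p ⟩
    length p ∸ t                ≤⟨ ∸-monoˡ-≤ t |p|≤|q| ⟩
    length q ∸ t                ≡⟨ sym (length-drop t q) ⟩
    length (drop t q)           ≤⟨ length≤sum (drop t q) (drop⁺ t 1≤q) ⟩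
    sum (drop t q)              ∎

mainTheorem11 : (n k k' : ℕ) → 1 ≤ n → 1 ≤ k → k < k' → k' ≤ n →
    (p : List ℕ) → InPhi n k p → IsMajor n k p →
    (q : List ℕ) → IsMotif n q → k' ≤ length q → length q ≤ n →
    q [ 1 ] ≤ p [ 1 ] → p ⪰ q
mainTheorem11 n k k' _ _ k<k' _ p ((_ , _ , Σp≡n) , |p|≡k) (l , _ , _ , _ , prefix≡l , _ , suffix≡1)
  q (q↘ , 1≤q , Σq≡n) k'≤|q| _ q₁≤p₁ t 1≤t t≤|p| _ with t ≤? beta n k l
... | yes t≤β = sum-take-≤-of-constant-prefix p q t t≤|p|
      (lookups⇒All-take p t (λ x 1≤x x≤t → prefix≡l x 1≤x (≤-trans x≤t t≤β)))
      (All-≤-head q q↘ (≤-trans q₁≤p₁ (≤-reflexive (prefix≡l 1 ≤-refl (≤-trans 1≤t t≤β)))))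
... | no t≰β = sum-take-≤-of-unit-suffix p q t (trans Σp≡n (sym Σq≡n)) |p|≤|q|
      (lookups⇒All-drop p t (λ x t<x x≤|p| → suffix≡1 x (≤-<-trans β+1≤t t<x) (≤-trans x≤|p| |p|≤k)))
      1≤q
  where
  |p|≤k : length p ≤ k
  |p|≤k = ≤-reflexive |p|≡k
  |p|≤|q| : length p ≤ length q
  |p|≤|q| = ≤-trans |p|≤k (≤-trans (<⇒≤ k<k') k'≤|q|)
  β+1≤t : beta n k l + 1 ≤ t
  β+1≤t = ≤-trans (≤-reflexive (+-comm _ 1)) (≰⇒> t≰β)
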